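{- Let $G$ be a finite abelian group and let $S$ be a proper subset of $G$. If $S\cap(2\ast G)\ne\varnothing$ (in particular, if $|G|$ is odd and $S$ is non-empty), then $$\kappa(\mathrm{Cay}^+_G(S))=\min\{|S+H|-|H| : H\le G,\ S+H\ne G\}.$$
   Context: For a subset $S$ of an abelian group $G$ (written additively), the addition Cayley graph $\mathrm{Cay}^+_G(S)$ is the undirected graph with vertex set $G$ in which $g_1,g_2$ are adjacent iff $g_1+g_2\in S$ (loops allowed). For a graph $\Gamma$ on a finite vertex set, $\kappa(\Gamma)$ is the smallest number of vertices whose removal leaves a graph that is disconnected or has only one vertex. $2\ast G=\{2g:g\in G\}$ and $S+H=\{s+h:s\in S,h\in H\}$. -}

module Defs where

open import Level using (0ℓ)
open import Data.Nat using (ℕ; zero; suc; _≤_; _∸_)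
open import Data.Bool using (Bool; true; false; if_then_else_; _∧_; not)
open import Data.Fin using (Fin)
open import Data.List using (List; map)
open import Data.Nat.ListAction using (sum)
open import Data.Bool.ListAction using (any)
open import Data.List.Base using (allFin)
open import Data.Product using (Σ; ∃; _×_; _,_)
open import Data.Sum using (_⊎_)
open import Relation.Nullary using (¬_)
open import Relation.Nullary.Decidable using (⌊_⌋)
open import Relation.Binary.Definitions using (DecidableEquality)
open import Relation.Binary.PropositionalEquality using (_≡_)
open import Function.Bundles using (_↔_; Inverse)
open import Algebra.Structures using (IsAbelianGroup)

record FinAbGroup : Set₁ where
  infixl 6 _+_
  field
    Carrier : Set
    _+_     : Carrier → Carrier → Carrier
    0#      : Carrier
    -_      : Carrier → Carrier
    isAbelianGroup : IsAbelianGroup _≡_ _+_ 0# -_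
    order   : ℕ
    enum    : Fin order ↔ Carrier
    _≟_     : DecidableEquality Carrier

  elt : Fin order → Carrier
  elt = Inverse.to enum

  elements : List Carrier
  elements = map elt (allFin order)

  Subset : Set
  Subset = Carrier → Bool

  _∈_ : Carrier → Subset → Set
  x ∈ A = A x ≡ true

  _∉_ : Carrier → Subset → Set
  x ∉ A = A x ≡ false

  card : Subset → ℕ
  card A = sum (map (λ x → if A x then 1 else 0) elements)

  complement : Subset → Subset
  complement A x = not (A x)

  sumset : Subset → Subset → Subset
  sumset A B g = any (λ a → any (λ b → A a ∧ B b ∧ ⌊ (a + b) ≟ g ⌋) elements) elements

  record IsSubgroup (H : Subset) : Set where
    field
      has-0  : 0# ∈ H
      +-closed : ∀ {x y} → x ∈ H → y ∈ H → (x + y) ∈ H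
      neg-closed : ∀ {x} → x ∈ H → (- x) ∈ H

  -- Addition Cayley graph Cay⁺_G(S): x ~ y iff x + y ∈ S
  Adj : Subset → Carrier → Carrier → Set
  Adj S x y = (x + y) ∈ S

  data Reach (S X : Subset) (u : Carrier) : Carrier → Set where
    here : Reach S X u u
    step : ∀ {v w} → Reach S X u v → w ∉ X → Adj S v w → Reach S X u w

  DisconnectedAfter : Subset → Subset → Set
  DisconnectedAfter S X = ∃ λ u → ∃ λ v → u ∉ X × v ∉ X × ¬ Reach S X u v

  IsCut : Subset → Subset → Set
  IsCut S X = card (complement X) ≤ 1 ⊎ DisconnectedAfter S X

IsMin : {A : Set} → (A → Set) → (A → ℕ) → ℕ → Set
IsMin {A} P f m = (Σ A λ a → P a × f a ≡ m) × (∀ a → P a → m ≤ f a)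

module _ (G : FinAbGroup) where
  open FinAbGroup G

  IsKappa : Subset → ℕ → Set
  IsKappa S k = IsMin (IsCut S) card k

  IsRHSMin : Subset → ℕ → Set
  IsRHSMin S k =
    IsMin (λ H → IsSubgroup H × ¬ (∀ g → g ∈ sumset S H))
          (λ H → card (sumset S H) ∸ card H) k

module Submission where

-- Write Γ A = {y : a + y ∈ S for some a ∈ A} for the neighbourhood of A in Cay⁺(S) and κ
-- for the least value of |Γ A| − |A| over nonempty A with Γ A ≠ G.  As 2t ∈ S, the map
-- y ↦ 2t − y sends A into Γ A, so |A| ≤ |Γ A|.  If removing X separates u from v, the
-- component R of u satisfies Γ R ⊆ R ∪ X, whence κ ≤ |X|; if at most one vertex survives,
-- |X| ≥ |G| − 1 ≥ |Γ {0}| − 1 ≥ κ.  Conversely, call the sets attaining κ fragments and a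
-- fragment of least size an atom.  Submodularity of |Γ|, together with the dual fragment
-- G ∖ Γ F of a fragment F, shows that an atom meeting a fragment lies inside it.  Translates
-- of atoms are atoms, so the atom H through 0 lies in x + H for each x ∈ H, i.e. H is a
-- subgroup.  For a subgroup Γ H = S + H, which gives the right-hand side, and the coset
-- C = t + H satisfies C ⊆ Γ C, so Γ C ∖ C is a cut with exactly κ vertices.

open import Defs
open import Algebra.Bundles using (AbelianGroup)
open import Algebra.Structures using (IsAbelianGroup)
import Algebra.Properties.AbelianGroup as AbelianGroupProperties
import Algebra.Properties.CommutativeMonoid.Sum as CommutativeMonoidSum
open import Data.Bool using (Bool; true; false; if_then_else_; _∧_; _∨_; not)
import Data.Bool as Bool
open import Data.Bool.ListAction using (any)
open import Data.Bool.Properties using (T-≡; ∧-conicalˡ; ∧-conicalʳ; ∧-zeroʳ; ∨-zeroʳ; ∨-conicalʳ)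
open import Data.Empty using (⊥; ⊥-elim)
open import Data.Fin using (Fin)
import Data.Fin.Subset as Fin
open import Data.Fin.Subset.Properties using (anySubset?)
open import Data.Fin.Permutation using (Permutation′; permutation)
open import Data.List using (List; []; _∷_; map; length; allFin; tabulate)
open import Data.List.Membership.Propositional using (lose) renaming (_∈_ to _∈ₗ_)
open import Data.List.Membership.Propositional.Properties using (∈-map⁺; ∈-allFin)
open import Data.List.Properties using (length-map; length-tabulate; map-∘; map-tabulate)
open import Data.List.Relation.Unary.Any using (here; there; satisfied; any?)
open import Data.List.Relation.Unary.Any.Properties using (any⁺; any⁻)
import Data.Nat as Nat
open Nat using (ℕ; zero; suc; _∸_; _≤_; _<_; z≤n; s≤s)
open import Data.Nat.ListAction using (sum)
open import Data.Nat.Properties hiding (_≟_)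
open import Algebra.Properties.CommutativeSemigroup +-commutativeSemigroup using (interchange; x∙yz≈y∙xz; x∙yz≈z∙xy)
open import Data.Product using (Σ; ∃; _×_; _,_; proj₁; proj₂)
open import Data.Sum using (_⊎_; inj₁; inj₂)
import Data.Vec as Vec
open import Data.Vec.Properties using (lookup∘tabulate)
open import Function using (_∘_; id; Inverse; Equivalence)
open import Level using (0ℓ)
open import Relation.Nullary using (¬_; Dec; yes; no; contradiction)
open import Relation.Nullary.Decidable using (⌊_⌋; _×-dec_; map′)
open import Relation.Binary.PropositionalEquality

module Counting {C : Set} where

  -- ℕ's _+_ is opened only locally: at top level, _+_ is the group operation of the statement.
  open Nat using (_+_)

  infix 4 _⊆_

  _⊆_ : (C → Bool) → (C → Bool) → Set
  A ⊆ B = ∀ {x} → A x ≡ true → B x ≡ true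

  count : (C → Bool) → List C → ℕ
  count A L = sum (map (λ x → if A x then 1 else 0) L)

  count-cong : ∀ {A B} → (∀ x → A x ≡ B x) → ∀ L → count A L ≡ count B L
  count-cong A≐B []      = refl
  count-cong A≐B (x ∷ L) rewrite A≐B x = cong (_ +_) (count-cong A≐B L)

  count-mono : ∀ {A B} → A ⊆ B → ∀ L → count A L ≤ count B L
  count-mono A⊆B [] = z≤n
  count-mono {A} {B} A⊆B (x ∷ L) with A x in ax | B x in bx
  ... | true  | true  = s≤s (count-mono A⊆B L)
  ... | true  | false with () ← trans (sym (A⊆B ax)) bx
  ... | false | true  = m≤n⇒m≤1+n (count-mono A⊆B L)
  ... | false | false = count-mono A⊆B L

  count-mono-< : ∀ {A B y L} → A ⊆ B → y ∈ₗ L → A y ≡ false → B y ≡ true →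
                 count A L < count B L
  count-mono-< {L = _ ∷ L} A⊆B (here refl) Ay By rewrite Ay | By = s≤s (count-mono A⊆B L)
  count-mono-< {A} {B} {L = x ∷ L} A⊆B (there y∈L) Ay By with A x in ax | B x in bx
  ... | true  | true  = s≤s (count-mono-< A⊆B y∈L Ay By)
  ... | true  | false with () ← trans (sym (A⊆B ax)) bx
  ... | false | true  = m≤n⇒m≤1+n (count-mono-< A⊆B y∈L Ay By)
  ... | false | false = count-mono-< A⊆B y∈L Ay By

  count-pos : ∀ {A y L} → y ∈ₗ L → A y ≡ true → 0 < count A L
  count-pos {A} (here refl) Ay rewrite Ay = s≤s z≤n
  count-pos {A} {L = x ∷ L} (there y∈L) Ay with A x
  ... | true  = s≤s z≤n
  ... | false = count-pos y∈L Ay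

  count-∨-∧ : ∀ A B L → count (λ x → A x ∨ B x) L + count (λ x → A x ∧ B x) L ≡ count A L + count B L
  count-∨-∧ A B [] = refl
  count-∨-∧ A B (x ∷ L) with A x | B x
  ... | true  | true  = cong suc (trans (+-suc _ _) (trans (cong suc (count-∨-∧ A B L)) (sym (+-suc _ _))))
  ... | true  | false = cong suc (count-∨-∧ A B L)
  ... | false | true  = trans (cong suc (count-∨-∧ A B L)) (sym (+-suc (count A L) (count B L)))
  ... | false | false = count-∨-∧ A B L

  count-∖ : ∀ {A B} → B ⊆ A → ∀ L → count (λ x → A x ∧ not (B x)) L + count B L ≡ count A L
  count-∖ B⊆A [] = refl
  count-∖ {A} {B} B⊆A (x ∷ L) with A x in ax | B x in bx
  ... | true  | true  = trans (+-suc _ _) (cong suc (count-∖ B⊆A L))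
  ... | true  | false = cong suc (count-∖ B⊆A L)
  ... | false | true  with () ← trans (sym (B⊆A bx)) ax
  ... | false | false = count-∖ B⊆A L

  count-not : ∀ A L → count A L + count (not ∘ A) L ≡ length L
  count-not A [] = refl
  count-not A (x ∷ L) with A x
  ... | true  = cong suc (count-not A L)
  ... | false = trans (+-suc _ _) (cong suc (count-not A L))

  count-≤-length : ∀ A L → count A L ≤ length L
  count-≤-length A L = subst (count A L ≤_) (count-not A L) (m≤m+n _ _)

  count-all : ∀ {A} → (∀ x → A x ≡ true) → ∀ L → count A L ≡ length L
  count-all all-A []      = refl
  count-all all-A (x ∷ L) rewrite all-A x = cong suc (count-all all-A L)

  any-≡-true⁺ : ∀ (p : C → Bool) {x L} → x ∈ₗ L → p x ≡ true → any p L ≡ true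
  any-≡-true⁺ p x∈L px = Equivalence.to T-≡ (any⁺ p (lose x∈L (Equivalence.from T-≡ px)))

  any-≡-true⁻ : ∀ (p : C → Bool) L → any p L ≡ true → ∃ λ x → p x ≡ true
  any-≡-true⁻ p L any-p with satisfied (any⁻ p L (Equivalence.from T-≡ any-p))
  ... | x , px = x , Equivalence.to T-≡ px

module FiniteSubsets (G : FinAbGroup) where

  open FinAbGroup G renaming (_+_ to _⊕_)
  open Nat using (_+_)
  open Counting {Carrier} public using (_⊆_)
  open Counting {Carrier} hiding (_⊆_)

  infix  4 _≐_
  -- Above the default precedence 20 of _∈_ from Defs, so that x ∈ A ∩ B parses.
  infixl 22 _∩_
  infixl 21 _∪_ _∖_

  _≐_ : Subset → Subset → Set
  A ≐ B = ∀ x → A x ≡ B x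

  _∩_ _∪_ _∖_ : Subset → Subset → Subset
  (A ∩ B) x = A x ∧ B x
  (A ∪ B) x = A x ∨ B x
  (A ∖ B) x = A x ∧ not (B x)

  ｛_｝ : Carrier → Subset
  ｛ u ｝ x = ⌊ x ≟ u ⌋

  ≐-sym : ∀ {A B} → A ≐ B → B ≐ A
  ≐-sym A≐B x = sym (A≐B x)

  ⊆-antisym : ∀ {A B} → A ⊆ B → B ⊆ A → A ≐ B
  ⊆-antisym {A} {B} A⊆B B⊆A x with A x in ax | B x in bx
  ... | true  | true  = refl
  ... | true  | false = trans (sym (A⊆B ax)) bx
  ... | false | true  = trans (sym ax) (B⊆A bx)
  ... | false | false = refl

  ¬∈⇒∉ : ∀ {A x} → ¬ x ∈ A → x ∉ A
  ¬∈⇒∉ {A} {x} x∉A with A x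
  ... | true  = contradiction refl x∉A
  ... | false = refl

  ¬∉⇒∈ : ∀ {A x} → ¬ x ∉ A → x ∈ A
  ¬∉⇒∈ {A} {x} x∈A with A x
  ... | true  = refl
  ... | false = contradiction refl x∈A

  ∉⇒¬∈ : ∀ {A x} → x ∉ A → ¬ x ∈ A
  ∉⇒¬∈ x∉A x∈A = contradiction (trans (sym x∈A) x∉A) λ ()

  ∧-≡-true : ∀ {b c} → b ≡ true → c ≡ true → b ∧ c ≡ true
  ∧-≡-true refl c≡true = c≡true

  ∈-∩ : ∀ {A B x} → x ∈ A → x ∈ B → x ∈ A ∩ B
  ∈-∩ = ∧-≡-true

  ∈-∩⁻ˡ : ∀ {A B x} → x ∈ A ∩ B → x ∈ A
  ∈-∩⁻ˡ {A} {B} {x} = ∧-conicalˡ (A x) (B x)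

  ∈-∩⁻ʳ : ∀ {A B x} → x ∈ A ∩ B → x ∈ B
  ∈-∩⁻ʳ {A} {B} {x} = ∧-conicalʳ (A x) (B x)

  ∉-∩ʳ : ∀ {A B x} → x ∉ B → x ∉ A ∩ B
  ∉-∩ʳ {A} {B} {x} x∉B rewrite x∉B = ∧-zeroʳ (A x)

  ∈-∪ˡ : ∀ {A B x} → x ∈ A → x ∈ A ∪ B
  ∈-∪ˡ x∈A rewrite x∈A = refl

  ∈-∪ʳ : ∀ {A B x} → x ∈ B → x ∈ A ∪ B
  ∈-∪ʳ {A} {B} {x} x∈B rewrite x∈B = ∨-zeroʳ (A x)

  ∈-∪⁻ : ∀ {A B x} → x ∈ A ∪ B → x ∈ A ⊎ x ∈ B
  ∈-∪⁻ {A} {B} {x} x∈A∪B with A x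
  ... | true  = inj₁ refl
  ... | false = inj₂ x∈A∪B

  ∈-∖ : ∀ {A B x} → x ∈ A → x ∉ B → x ∈ A ∖ B
  ∈-∖ x∈A x∉B rewrite x∈A | x∉B = refl

  ∈-∖⁻ˡ : ∀ {A B x} → x ∈ A ∖ B → x ∈ A
  ∈-∖⁻ˡ {A} {B} {x} = ∧-conicalˡ (A x) (not (B x))

  ∈-∖⁻ʳ : ∀ {A B x} → x ∈ A ∖ B → x ∉ B
  ∈-∖⁻ʳ {A} {B} {x} x∈A∖B with B x
  ... | false = refl
  ... | true  with () ← ∧-conicalʳ (A x) false x∈A∖B

  ∉-∪⁻ʳ : ∀ {A B x} → x ∉ A ∪ B → x ∉ B
  ∉-∪⁻ʳ {A} {B} {x} = ∨-conicalʳ (A x) (B x)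

  ∈⇒∉-∖ : ∀ {A B x} → x ∈ B → x ∉ A ∖ B
  ∈⇒∉-∖ {A} {B} {x} x∈B rewrite x∈B = ∧-zeroʳ (A x)

  ∉⇒∉-∖ : ∀ {A B x} → x ∉ A → x ∉ A ∖ B
  ∉⇒∉-∖ x∉A rewrite x∉A = refl

  ∉-∖⇒∈ : ∀ {A B x} → x ∈ A → x ∉ A ∖ B → x ∈ B
  ∉-∖⇒∈ {A} {B} {x} x∈A x∉A∖B rewrite x∈A with B x
  ... | true  = refl
  ... | false with () ← x∉A∖B

  ∈-complement : ∀ {A x} → x ∉ A → x ∈ complement A
  ∈-complement x∉A rewrite x∉A = refl

  ∈-complement⁻ : ∀ {A x} → x ∈ complement A → x ∉ A
  ∈-complement⁻ {A} {x} x∈Aᶜ with A x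
  ... | false = refl

  ∈-｛｝ : ∀ u → u ∈ ｛ u ｝
  ∈-｛｝ u with u ≟ u
  ... | yes _   = refl
  ... | no u≢u = contradiction refl u≢u

  ∈-｛｝⁻ : ∀ {u x} → x ∈ ｛ u ｝ → x ≡ u
  ∈-｛｝⁻ {u} {x} x∈｛u｝ with x ≟ u
  ... | yes x≡u = x≡u

  ∈-elements : ∀ x → x ∈ₗ elements
  ∈-elements x = subst (_∈ₗ elements) (Inverse.strictlyInverseˡ enum x) (∈-map⁺ elt (∈-allFin _))

  length-elements : length elements ≡ order
  length-elements = trans (length-map elt (allFin order)) (length-tabulate id)

  card-cong : ∀ {A B} → A ≐ B → card A ≡ card B
  card-cong A≐B = count-cong A≐B elements

  card-mono : ∀ {A B} → A ⊆ B → card A ≤ card B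
  card-mono A⊆B = count-mono A⊆B elements

  card-mono-< : ∀ {A B x} → A ⊆ B → x ∉ A → x ∈ B → card A < card B
  card-mono-< {A} {B} {x} A⊆B = count-mono-< {A} {B} A⊆B (∈-elements x)

  card-pos : ∀ {A x} → x ∈ A → 0 < card A
  card-pos {x = x} = count-pos (∈-elements x)

  card-∪-∩ : ∀ A B → card (A ∪ B) + card (A ∩ B) ≡ card A + card B
  card-∪-∩ A B = count-∨-∧ A B elements

  card-∖ : ∀ {A B} → B ⊆ A → card (A ∖ B) + card B ≡ card A
  card-∖ B⊆A = count-∖ B⊆A elements

  card-complement : ∀ A → card A + card (complement A) ≡ order
  card-complement A = trans (count-not A elements) length-elements

  card≤order : ∀ A → card A ≤ order
  card≤order A = subst (card A ≤_) length-elements (count-≤-length A elements)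

  card-full : ∀ {A} → (∀ x → x ∈ A) → card A ≡ order
  card-full A-full = trans (count-all A-full elements) length-elements

  nonEmpty? : ∀ A → Dec (∃ λ x → x ∈ A)
  nonEmpty? A = map′ satisfied (λ (x , x∈A) → lose (∈-elements x) x∈A)
                     (any? (λ x → A x Bool.≟ true) elements)

  notFull? : ∀ A → Dec (∃ λ x → x ∉ A)
  notFull? A = map′ satisfied (λ (x , x∉A) → lose (∈-elements x) x∉A)
                    (any? (λ x → A x Bool.≟ false) elements)

  ¬full⇒∃∉ : ∀ A → ¬ (∀ x → x ∈ A) → ∃ λ x → x ∉ A
  ¬full⇒∃∉ A A-not-full with notFull? A
  ... | yes ∃∉ = ∃∉
  ... | no ∄∉  = contradiction (λ x → ¬∉⇒∈ {A} λ x∉A → ∄∉ (x , x∉A)) A-not-full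

  ⊆⊎∃∖ : ∀ A B → A ⊆ B ⊎ ∃ λ x → x ∈ A × x ∉ B
  ⊆⊎∃∖ A B with nonEmpty? (A ∖ B)
  ... | yes (x , x∈A∖B) = inj₂ (x , ∈-∖⁻ˡ {A} {B} x∈A∖B , ∈-∖⁻ʳ {A} {B} x∈A∖B)
  ... | no ∄            = inj₁ λ x∈A → ∉-∖⇒∈ {A} {B} x∈A (¬∈⇒∉ {A ∖ B} λ x∈A∖B → ∄ (_ , x∈A∖B))

  private
    open CommutativeMonoidSum +-0-commutativeMonoid using (sum-permute; sum-cong-≗) renaming (sum to ∑)

    indicator : Subset → Carrier → ℕ
    indicator A x = if A x then 1 else 0

    sum-tabulate : ∀ {n} (g : Fin n → ℕ) → sum (tabulate g) ≡ ∑ g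
    sum-tabulate {zero}  g = refl
    sum-tabulate {suc n} g = cong (g Fin.zero +_) (sum-tabulate (g ∘ Fin.suc))

    card≡∑ : ∀ A → card A ≡ ∑ (indicator A ∘ elt)
    card≡∑ A = begin
      sum (map (indicator A) (map elt (allFin order))) ≡⟨ cong sum (map-∘ (allFin order)) ⟨
      sum (map (indicator A ∘ elt) (tabulate id))      ≡⟨ cong sum (map-tabulate id (indicator A ∘ elt)) ⟩
      sum (tabulate (indicator A ∘ elt))               ≡⟨ sum-tabulate (indicator A ∘ elt) ⟩
      ∑ (indicator A ∘ elt)                            ∎
      where open ≡-Reasoning

    conjugate-inverse : ∀ {σ σ′ : Carrier → Carrier} → (∀ x → σ (σ′ x) ≡ x) →
                        ∀ i → Inverse.from enum (σ (elt (Inverse.from enum (σ′ (elt i))))) ≡ i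
    conjugate-inverse {σ} {σ′} σσ′ i = begin
      from (σ (elt (from (σ′ (elt i))))) ≡⟨ cong (from ∘ σ) (Inverse.strictlyInverseˡ enum _) ⟩
      from (σ (σ′ (elt i)))               ≡⟨ cong from (σσ′ (elt i)) ⟩
      from (elt i)                        ≡⟨ Inverse.strictlyInverseʳ enum i ⟩
      i                                   ∎
      where
      open ≡-Reasoning
      from : Carrier → Fin order
      from = Inverse.from enum

  card-∘-inverse : ∀ A {σ σ′ : Carrier → Carrier} →
                   (∀ x → σ (σ′ x) ≡ x) → (∀ x → σ′ (σ x) ≡ x) → card (A ∘ σ) ≡ card A
  card-∘-inverse A {σ} {σ′} σσ′ σ′σ = begin
    card (A ∘ σ)              ≡⟨ card≡∑ (A ∘ σ) ⟩
    ∑ (indicator A ∘ σ ∘ elt) ≡⟨ sum-cong-≗ (λ i → cong (indicator A) (Inverse.strictlyInverseˡ enum (σ (elt i)))) ⟨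
    ∑ (indicator A ∘ elt ∘ π) ≡⟨ sum-permute (indicator A ∘ elt) π↔ ⟨
    ∑ (indicator A ∘ elt)     ≡⟨ card≡∑ A ⟨
    card A                    ∎
    where
    open ≡-Reasoning
    π π′ : Fin order → Fin order
    π  i = Inverse.from enum (σ (elt i))
    π′ i = Inverse.from enum (σ′ (elt i))

    π↔ : Permutation′ order
    π↔ = permutation π π′ (conjugate-inverse {σ} {σ′} σσ′) (conjugate-inverse {σ′} {σ} σ′σ)

  abelianGroup : AbelianGroup 0ℓ 0ℓ
  abelianGroup = record
    { Carrier = Carrier ; _≈_ = _≡_ ; _∙_ = _⊕_ ; ε = 0# ; _⁻¹ = -_
    ; isAbelianGroup = isAbelianGroup }

  open IsAbelianGroup isAbelianGroup using (_-_; comm; identityˡ)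
  open AbelianGroupProperties abelianGroup using (//-rightDividesˡ; //-rightDividesʳ; xyx⁻¹≈y; ⁻¹-involutive)

  infixr 25 _+ₛ_

  _+ₛ_ : Carrier → Subset → Subset
  (c +ₛ A) y = A (y - c)

  card-∘-⊕ : ∀ A c → card (λ y → A (y ⊕ c)) ≡ card A
  card-∘-⊕ A c = card-∘-inverse A {_⊕ c} {_- c} (//-rightDividesˡ c) (//-rightDividesʳ c)

  card-+ₛ : ∀ c A → card (c +ₛ A) ≡ card A
  card-+ₛ c A = card-∘-⊕ A (- c)

  subgroup-criterion : ∀ {H} → 0# ∈ H → (∀ {x y} → x ∈ H → y ∈ H → (y - x) ∈ H) → IsSubgroup H
  subgroup-criterion {H} 0∈H −-closed = record
    { has-0      = 0∈H
    ; +-closed   = +-closed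
    ; neg-closed = neg-closed
    }
    where
    neg-closed : ∀ {x} → x ∈ H → (- x) ∈ H
    neg-closed {x} x∈H = subst (_∈ H) (identityˡ (- x)) (−-closed x∈H 0∈H)

    +-closed : ∀ {x y} → x ∈ H → y ∈ H → (x ⊕ y) ∈ H
    +-closed {x} {y} x∈H y∈H =
      subst (_∈ H) (trans (cong (y ⊕_) (⁻¹-involutive x)) (comm y x)) (−-closed (neg-closed x∈H) y∈H)

  fromVec : Fin.Subset order → Subset
  fromVec v x = Vec.lookup v (Inverse.from enum x)

  toVec : Subset → Fin.Subset order
  toVec A = Vec.tabulate (A ∘ elt)

  fromVec-toVec : ∀ A → fromVec (toVec A) ≐ A
  fromVec-toVec A x = trans (lookup∘tabulate (A ∘ elt) _) (cong A (Inverse.strictlyInverseˡ enum x))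

  -- Descent on the value of f; each step decides, over all subsets, whether a smaller value is attained.
  module _ {P : Subset → Set} (P? : ∀ A → Dec (P A)) (P-resp : ∀ {A B} → A ≐ B → P A → P B)
           (f : Subset → ℕ) (f-resp : ∀ {A B} → A ≐ B → f A ≡ f B) where

    private
      descend : ∀ n A → P A → f A ≤ n → Σ Subset λ M → P M × (∀ B → P B → f M ≤ f B)
      descend n A pA fA≤n with anySubset? (λ v → P? (fromVec v) ×-dec (f (fromVec v) Nat.<? f A))
      ... | no ∄smaller = A , pA , λ B pB → ≮⇒≥ λ fB<fA →
        ∄smaller (toVec B , P-resp (≐-sym (fromVec-toVec B)) pB ,
                  subst (_< f A) (sym (f-resp (fromVec-toVec B))) fB<fA)
      descend zero    A pA fA≤0 | yes (_ , _ , fv<fA) = contradiction (≤-trans fv<fA fA≤0) λ ()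
      descend (suc n) A pA fA≤n | yes (v , pv , fv<fA) = descend n (fromVec v) pv (≤-pred (≤-trans fv<fA fA≤n))

    minimum : ∀ {A} → P A → Σ Subset λ M → P M × (∀ B → P B → f M ≤ f B)
    minimum {A} pA = descend (f A) A pA ≤-refl

  private
    chain-growth : (R : ℕ → Subset) → (∀ k → R k ⊆ R (suc k)) →
                   ∀ k → (∃ λ j → R (suc j) ⊆ R j) ⊎ k ≤ card (R k)
    chain-growth R increasing zero = inj₂ z≤n
    chain-growth R increasing (suc k) with chain-growth R increasing k | ⊆⊎∃∖ (R (suc k)) (R k)
    ... | inj₁ stable | _                    = inj₁ stable
    ... | inj₂ _      | inj₁ stable          = inj₁ (k , stable)
    ... | inj₂ k≤card | inj₂ (y , y∈ , y∉) =
      inj₂ (≤-trans (s≤s k≤card) (card-mono-< {R k} {R (suc k)} (increasing k) y∉ y∈))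

  chain-stabilises : (R : ℕ → Subset) → (∀ k → R k ⊆ R (suc k)) → ∃ λ j → R (suc j) ⊆ R j
  chain-stabilises R increasing with chain-growth R increasing (suc order)
  ... | inj₁ stable    = stable
  ... | inj₂ order<card = contradiction order<card (≤⇒≯ (card≤order (R (suc order))))

  ∈-sumset : ∀ {A B a b} → a ∈ A → b ∈ B → (a ⊕ b) ∈ sumset A B
  ∈-sumset {A} {B} {a} {b} a∈A b∈B =
    any-≡-true⁺ _ (∈-elements a) (any-≡-true⁺ _ (∈-elements b)
      (∧-≡-true a∈A (∧-≡-true b∈B (∈-｛｝ (a ⊕ b)))))

  ∈-sumset⁻ : ∀ {A B g} → g ∈ sumset A B → ∃ λ a → ∃ λ b → a ∈ A × b ∈ B × a ⊕ b ≡ g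
  ∈-sumset⁻ {A} {B} {g} g∈A+B with any-≡-true⁻ _ elements g∈A+B
  ... | a , ∃b with any-≡-true⁻ _ elements ∃b
  ... | b , a∈A∧b∈B∧a+b≡g with ∧-conicalʳ (A a) _ a∈A∧b∈B∧a+b≡g
  ... | b∈B∧a+b≡g =
    a , b , ∧-conicalˡ (A a) _ a∈A∧b∈B∧a+b≡g , ∧-conicalˡ (B b) _ b∈B∧a+b≡g ,
    ∈-｛｝⁻ {g} (∧-conicalʳ (B b) _ b∈B∧a+b≡g)

module Neighbourhood (G : FinAbGroup) (S : FinAbGroup.Subset G) where

  open FinAbGroup G renaming (_+_ to _⊕_)
  open Nat using (_+_)
  open FiniteSubsets G
  open Counting {Carrier} using (any-≡-true⁺; any-≡-true⁻)
  open IsAbelianGroup isAbelianGroup using (_-_; assoc; comm)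
  open AbelianGroupProperties abelianGroup
    using (//-rightDividesˡ; //-rightDividesʳ; xyx⁻¹≈y; ⁻¹-anti-homo‿-)

  -- Γ A may meet A, so the vertex boundary of A is Γ A ∖ A.
  Γ : Subset → Subset
  Γ A y = any (λ a → A a ∧ S (a ⊕ y)) elements

  ∈-Γ : ∀ {A a y} → a ∈ A → (a ⊕ y) ∈ S → y ∈ Γ A
  ∈-Γ {a = a} a∈A a+y∈S = any-≡-true⁺ _ (∈-elements a) (∧-≡-true a∈A a+y∈S)

  ∈-Γ⁻ : ∀ {A y} → y ∈ Γ A → ∃ λ a → a ∈ A × (a ⊕ y) ∈ S
  ∈-Γ⁻ {A} {y} y∈ΓA with any-≡-true⁻ _ elements y∈ΓA
  ... | a , a∈A∧a+y∈S = a , ∧-conicalˡ (A a) _ a∈A∧a+y∈S , ∧-conicalʳ (A a) _ a∈A∧a+y∈S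

  Γ-mono : ∀ {A B} → A ⊆ B → Γ A ⊆ Γ B
  Γ-mono A⊆B y∈ΓA with ∈-Γ⁻ y∈ΓA
  ... | a , a∈A , a+y∈S = ∈-Γ (A⊆B a∈A) a+y∈S

  Γ-cong : ∀ {A B} → A ≐ B → Γ A ≐ Γ B
  Γ-cong {A} {B} A≐B = ⊆-antisym (Γ-mono λ {x} → subst (_≡ true) (A≐B x))
                                 (Γ-mono λ {x} → subst (_≡ true) (sym (A≐B x)))

  Γ-∪ : ∀ {A B} → Γ (A ∪ B) ⊆ Γ A ∪ Γ B
  Γ-∪ {A} {B} y∈Γ[A∪B] with ∈-Γ⁻ y∈Γ[A∪B]
  ... | a , a∈A∪B , a+y∈S with ∈-∪⁻ {A} {B} a∈A∪B
  ...   | inj₁ a∈A = ∈-∪ˡ {Γ A} {Γ B} (∈-Γ a∈A a+y∈S)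
  ...   | inj₂ a∈B = ∈-∪ʳ {Γ A} {Γ B} (∈-Γ a∈B a+y∈S)

  Γ-∩ : ∀ {A B} → Γ (A ∩ B) ⊆ Γ A ∩ Γ B
  Γ-∩ {A} {B} y∈Γ[A∩B] with ∈-Γ⁻ y∈Γ[A∩B]
  ... | a , a∈A∩B , a+y∈S =
    ∈-∩ {Γ A} {Γ B} (∈-Γ (∈-∩⁻ˡ {A} {B} a∈A∩B) a+y∈S) (∈-Γ (∈-∩⁻ʳ {A} {B} a∈A∩B) a+y∈S)

  card-Γ-submodular : ∀ A B → card (Γ (A ∪ B)) + card (Γ (A ∩ B)) ≤ card (Γ A) + card (Γ B)
  card-Γ-submodular A B = ≤-trans (+-mono-≤ (card-mono (Γ-∪ {A} {B})) (card-mono (Γ-∩ {A} {B})))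
                                  (≤-reflexive (card-∪-∩ (Γ A) (Γ B)))

  Γ-+ₛ : ∀ c A → Γ (c +ₛ A) ≐ λ y → Γ A (y ⊕ c)
  Γ-+ₛ c A = ⊆-antisym to from
    where
    shuffle : ∀ a y → (a ⊕ c) ⊕ y ≡ a ⊕ (y ⊕ c)
    shuffle a y = trans (assoc a c y) (cong (a ⊕_) (comm c y))

    to : Γ (c +ₛ A) ⊆ λ y → Γ A (y ⊕ c)
    to y∈Γ[c+A] with ∈-Γ⁻ y∈Γ[c+A]
    ... | b , b-c∈A , b+y∈S =
      ∈-Γ b-c∈A (subst (_∈ S) (trans (cong (_⊕ _) (sym (//-rightDividesˡ c b))) (shuffle (b - c) _)) b+y∈S)

    from : (λ y → Γ A (y ⊕ c)) ⊆ Γ (c +ₛ A)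
    from y+c∈ΓA with ∈-Γ⁻ y+c∈ΓA
    ... | a , a∈A , a+[y+c]∈S =
      ∈-Γ {c +ₛ A} (subst (_∈ A) (sym (xyx⁻¹≈y c a)) a∈A)
                   (subst (_∈ S) (sym (trans (cong (_⊕ _) (comm c a)) (shuffle a _))) a+[y+c]∈S)

  card-Γ-+ₛ : ∀ c A → card (Γ (c +ₛ A)) ≡ card (Γ A)
  card-Γ-+ₛ c A = trans (card-cong (Γ-+ₛ c A)) (card-∘-⊕ (Γ A) c)

  Γ-complement-Γ : ∀ A → Γ (complement (Γ A)) ⊆ complement A
  Γ-complement-Γ A y∈Γ[ΓAᶜ] with ∈-Γ⁻ y∈Γ[ΓAᶜ]
  ... | w , w∈ΓAᶜ , w+y∈S = ∈-complement {A} (¬∈⇒∉ {A} λ y∈A →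
    ∉⇒¬∈ {Γ A} (∈-complement⁻ {Γ A} w∈ΓAᶜ) (∈-Γ y∈A (subst (_∈ S) (comm w _) w+y∈S)))

  Γ-subgroup : ∀ {K} → IsSubgroup K → Γ K ≐ sumset S K
  Γ-subgroup {K} K≤G = ⊆-antisym to from
    where
    open IsSubgroup K≤G

    to : Γ K ⊆ sumset S K
    to {y} y∈ΓK with ∈-Γ⁻ y∈ΓK
    ... | k , k∈K , k+y∈S = subst (_∈ sumset S K) (xyx⁻¹≈y k y) (∈-sumset {S} {K} k+y∈S (neg-closed k∈K))

    from : sumset S K ⊆ Γ K
    from g∈S+K with ∈-sumset⁻ {S} {K} g∈S+K
    ... | s , k , s∈S , k∈K , refl =
      ∈-Γ (neg-closed k∈K) (subst (_∈ S) (sym (trans (comm (- k) _) (//-rightDividesʳ k s))) s∈S)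

  reflection-involutive : ∀ s y → s - (s - y) ≡ y
  reflection-involutive s y = begin
    s ⊕ - (s - y) ≡⟨ cong (s ⊕_) (⁻¹-anti-homo‿- s y) ⟩
    s ⊕ (y - s)   ≡⟨ assoc s y (- s) ⟨
    s ⊕ y - s     ≡⟨ xyx⁻¹≈y s y ⟩
    y             ∎
    where open ≡-Reasoning

  -- The reflection y ↦ s − y maps A into Γ A.
  card≤card-Γ : ∀ {s} → s ∈ S → ∀ A → card A ≤ card (Γ A)
  card≤card-Γ {s} s∈S A =
    subst (_≤ card (Γ A)) (card-∘-inverse A (reflection-involutive s) (reflection-involutive s))
          (card-mono {λ y → A (s - y)} λ {y} s-y∈A → ∈-Γ s-y∈A (subst (_∈ S) (sym (//-rightDividesˡ y s)) s∈S))

  reach-closed : ∀ {X C u w} → (∀ {y} → y ∈ Γ C → y ∉ X → y ∈ C) → u ∈ C → Reach S X u w → w ∈ C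
  reach-closed C-closed u∈C here                      = u∈C
  reach-closed C-closed u∈C (step u↝v w∉X v+w∈S) = C-closed (∈-Γ (reach-closed C-closed u∈C u↝v) v+w∈S) w∉X

  module _ (X : Subset) (u : Carrier) where

    private
      stage : ℕ → Subset
      stage zero    = ｛ u ｝
      stage (suc k) = stage k ∪ (Γ (stage k) ∖ X)

      stage-∋u : ∀ k → u ∈ stage k
      stage-∋u zero    = ∈-｛｝ u
      stage-∋u (suc k) = ∈-∪ˡ {stage k} {Γ (stage k) ∖ X} (stage-∋u k)

      stage-reachable : ∀ k {y} → y ∈ stage k → Reach S X u y
      stage-reachable zero y∈｛u｝ rewrite ∈-｛｝⁻ {u} y∈｛u｝ = here
      stage-reachable (suc k) y∈stage with ∈-∪⁻ {stage k} {Γ (stage k) ∖ X} y∈stage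
      ... | inj₁ y∈stageₖ = stage-reachable k y∈stageₖ
      ... | inj₂ y∈Γ∖X with ∈-Γ⁻ (∈-∖⁻ˡ {Γ (stage k)} {X} y∈Γ∖X)
      ...   | a , a∈stageₖ , a+y∈S = step (stage-reachable k a∈stageₖ) (∈-∖⁻ʳ {Γ (stage k)} {X} y∈Γ∖X) a+y∈S

    component : Σ Subset λ R → u ∈ R × (∀ {y} → y ∈ R → Reach S X u y) ×
                               (∀ {y} → y ∈ Γ R → y ∉ X → y ∈ R)
    component with chain-stabilises stage (λ k → ∈-∪ˡ {stage k} {Γ (stage k) ∖ X})
    ... | j , stable = stage j , stage-∋u j , stage-reachable j ,
                       λ y∈Γ y∉X → stable (∈-∪ʳ {stage j} {Γ (stage j) ∖ X} (∈-∖ {Γ (stage j)} {X} y∈Γ y∉X))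

module Connectivity (G : FinAbGroup) (S : FinAbGroup.Subset G)
  {g₀ : FinAbGroup.Carrier G} (g₀∉S : FinAbGroup._∉_ G g₀ S)
  {t : FinAbGroup.Carrier G} (t+t∈S : FinAbGroup._∈_ G (FinAbGroup._+_ G t t) S) where

  open FinAbGroup G renaming (_+_ to _⊕_)
  open Nat using (_+_)
  open FiniteSubsets G
  open Neighbourhood G S
  open IsAbelianGroup isAbelianGroup using (_-_; assoc; identityˡ; inverseʳ)
  open AbelianGroupProperties abelianGroup using (//-rightDividesˡ; //-rightDividesʳ; xyx⁻¹≈y; ⁻¹-involutive)

  -- No truncation occurs, by card-Γ.
  expansion : Subset → ℕ
  expansion A = card (Γ A) ∸ card A

  card-Γ : ∀ A → card (Γ A) ≡ expansion A + card A
  card-Γ A = sym (m∸n+n≡m (card≤card-Γ t+t∈S A))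

  expansion-cong : ∀ {A B} → A ≐ B → expansion A ≡ expansion B
  expansion-cong A≐B = cong₂ _∸_ (card-cong (Γ-cong A≐B)) (card-cong A≐B)

  expansion-+ₛ : ∀ c A → expansion (c +ₛ A) ≡ expansion A
  expansion-+ₛ c A = cong₂ _∸_ (card-Γ-+ₛ c A) (card-+ₛ c A)

  expansion-submodular : ∀ A B → expansion (A ∪ B) + expansion (A ∩ B) ≤ expansion A + expansion B
  expansion-submodular A B = +-cancelʳ-≤ (card (A ∪ B) + card (A ∩ B)) _ _ (begin
    (e[A∪B] + e[A∩B]) + (card (A ∪ B) + card (A ∩ B)) ≡⟨ interchange e[A∪B] e[A∩B] _ _ ⟩
    (e[A∪B] + card (A ∪ B)) + (e[A∩B] + card (A ∩ B)) ≡⟨ cong₂ _+_ (card-Γ (A ∪ B)) (card-Γ (A ∩ B)) ⟨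
    card (Γ (A ∪ B)) + card (Γ (A ∩ B))               ≤⟨ card-Γ-submodular A B ⟩
    card (Γ A) + card (Γ B)                           ≡⟨ cong₂ _+_ (card-Γ A) (card-Γ B) ⟩
    (expansion A + card A) + (expansion B + card B)   ≡⟨ interchange (expansion A) _ _ _ ⟩
    (expansion A + expansion B) + (card A + card B)   ≡⟨ cong ((expansion A + expansion B) +_) (card-∪-∩ A B) ⟨
    (expansion A + expansion B) + (card (A ∪ B) + card (A ∩ B)) ∎)
    where
    open ≤-Reasoning
    e[A∪B] e[A∩B] : ℕ
    e[A∪B] = expansion (A ∪ B)
    e[A∩B] = expansion (A ∩ B)

  Separating : Subset → Set
  Separating A = (∃ λ x → x ∈ A) × (∃ λ y → y ∉ Γ A)

  separating? : ∀ A → Dec (Separating A)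
  separating? A = nonEmpty? A ×-dec notFull? (Γ A)

  separating-cong : ∀ {A B} → A ≐ B → Separating A → Separating B
  separating-cong A≐B ((x , x∈A) , (y , y∉ΓA)) =
    (x , trans (sym (A≐B x)) x∈A) , (y , trans (sym (Γ-cong A≐B y)) y∉ΓA)

  separating-+ₛ : ∀ c {A} → Separating A → Separating (c +ₛ A)
  separating-+ₛ c {A} ((x , x∈A) , (y , y∉ΓA)) =
    (x ⊕ c , subst (_∈ A) (sym (//-rightDividesʳ c x)) x∈A) ,
    (y - c , trans (Γ-+ₛ c A (y - c)) (subst (_∉ Γ A) (sym (//-rightDividesˡ c y)) y∉ΓA))

  separating-｛0｝ : Separating ｛ 0# ｝
  separating-｛0｝ = (0# , ∈-｛｝ 0#) , (g₀ , ¬∈⇒∉ {Γ ｛ 0# ｝} g₀∉Γ｛0｝)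
    where
    g₀∉Γ｛0｝ : ¬ g₀ ∈ Γ ｛ 0# ｝
    g₀∉Γ｛0｝ g₀∈Γ｛0｝ with ∈-Γ⁻ {｛ 0# ｝} g₀∈Γ｛0｝
    ... | a , a∈｛0｝ , a+g₀∈S rewrite ∈-｛｝⁻ {0#} a∈｛0｝ =
      ∉⇒¬∈ {S} g₀∉S (subst (_∈ S) (identityˡ g₀) a+g₀∈S)

  private
    least-separating : Σ Subset λ M → Separating M × (∀ B → Separating B → expansion M ≤ expansion B)
    least-separating = minimum separating? separating-cong expansion expansion-cong separating-｛0｝

  κ : ℕ
  κ = expansion (proj₁ least-separating)

  κ-min : ∀ {A} → Separating A → κ ≤ expansion A
  κ-min {A} = proj₂ (proj₂ least-separating) A

  IsFragment : Subset → Set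
  IsFragment A = Separating A × expansion A ≡ κ

  IsAtom : Subset → Set
  IsAtom A = IsFragment A × (∀ B → IsFragment B → card A ≤ card B)

  fragment-cong : ∀ {A B} → A ≐ B → IsFragment A → IsFragment B
  fragment-cong A≐B (A-sep , eA≡κ) = separating-cong A≐B A-sep , trans (sym (expansion-cong A≐B)) eA≡κ

  fragment-+ₛ : ∀ c {A} → IsFragment A → IsFragment (c +ₛ A)
  fragment-+ₛ c {A} (A-sep , eA≡κ) = separating-+ₛ c A-sep , trans (expansion-+ₛ c A) eA≡κ

  atom-+ₛ : ∀ c {A} → IsAtom A → IsAtom (c +ₛ A)
  atom-+ₛ c {A} (A-frag , A-least) =
    fragment-+ₛ c A-frag , λ B B-frag → subst (_≤ card B) (sym (card-+ₛ c A)) (A-least B B-frag)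

  atom : Σ Subset IsAtom
  atom = minimum (λ A → separating? A ×-dec (expansion A Nat.≟ κ)) fragment-cong card card-cong
                 (proj₁ (proj₂ least-separating) , refl)

  card-complement-Γ : ∀ {F} → IsFragment F → card (complement (Γ F)) + (κ + card F) ≡ order
  card-complement-Γ {F} (_ , eF≡κ) = begin
    card (complement (Γ F)) + (κ + card F) ≡⟨ cong (λ e → card (complement (Γ F)) + (e + card F)) eF≡κ ⟨
    card (complement (Γ F)) + (expansion F + card F) ≡⟨ cong (card (complement (Γ F)) +_) (card-Γ F) ⟨
    card (complement (Γ F)) + card (Γ F) ≡⟨ +-comm _ (card (Γ F)) ⟩
    card (Γ F) + card (complement (Γ F)) ≡⟨ card-complement (Γ F) ⟩
    order ∎
    where open ≡-Reasoning

  fragment-complement-Γ : ∀ {F} → IsFragment F → IsFragment (complement (Γ F))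
  fragment-complement-Γ {F} F-frag@(((x , x∈F) , (y , y∉ΓF)) , _) = F*-sep , ≤-antisym eF*≤κ (κ-min F*-sep)
    where
    F* : Subset
    F* = complement (Γ F)

    F*-sep : Separating F*
    F*-sep = (y , ∈-complement {Γ F} y∉ΓF) ,
             (x , ¬∈⇒∉ {Γ F*} λ x∈ΓF* → ∉⇒¬∈ {F} (∈-complement⁻ {F} (Γ-complement-Γ F x∈ΓF*)) x∈F)

    card-Fᶜ : card (complement F) ≡ card F* + κ
    card-Fᶜ = +-cancelˡ-≡ (card F) _ _ (begin
      card F + card (complement F) ≡⟨ card-complement F ⟩
      order                        ≡⟨ card-complement-Γ F-frag ⟨
      card F* + (κ + card F)       ≡⟨ x∙yz≈z∙xy (card F*) κ (card F) ⟩
      card F + (card F* + κ)       ∎)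
      where open ≡-Reasoning

    eF*≤κ : expansion F* ≤ κ
    eF*≤κ = begin
      card (Γ F*) ∸ card F*           ≤⟨ ∸-monoˡ-≤ (card F*) (card-mono (Γ-complement-Γ F)) ⟩
      card (complement F) ∸ card F*   ≡⟨ cong (_∸ card F*) card-Fᶜ ⟩
      card F* + κ ∸ card F*           ≡⟨ m+n∸m≡n (card F*) κ ⟩
      κ                               ∎
      where open ≤-Reasoning

  -- Submodularity forces expansion (A ∪ F) < κ, hence Γ (A ∪ F) = G; counting against the dual
  -- fragment G ∖ Γ F, which is at least as large as the atom A, then gives expansion (A ∪ F) > κ.
  private
    atom-∖-fragment-empty : ∀ {A F x y} → IsAtom A → IsFragment F → x ∈ A → x ∈ F → y ∈ A → y ∉ F → ⊥
    atom-∖-fragment-empty {A} {F} {x} {y} (((_ , (z , z∉ΓA)) , eA≡κ) , A-least) F-frag@(_ , eF≡κ)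
                          x∈A x∈F y∈A y∉F = <-asym eU<κ κ<eU
      where
      open ≤-Reasoning

      U I F* : Subset
      U  = A ∪ F
      I  = A ∩ F
      F* = complement (Γ F)

      I-sep : Separating I
      I-sep = (x , ∈-∩ {A} {F} x∈A x∈F) ,
              (z , ¬∈⇒∉ {Γ I} λ z∈ΓI → ∉⇒¬∈ {Γ A} z∉ΓA (∈-∩⁻ˡ {Γ A} {Γ F} (Γ-∩ {A} {F} z∈ΓI)))

      κ<eI : κ < expansion I
      κ<eI = ≤∧≢⇒< (κ-min I-sep) λ κ≡eI →
        <⇒≱ (card-mono-< {I} {A} (∈-∩⁻ˡ {A} {F}) (∉-∩ʳ {A} {F} y∉F) y∈A) (A-least I (I-sep , sym κ≡eI))

      eU<κ : expansion U < κ
      eU<κ = +-cancelʳ-≤ κ (suc (expansion U)) κ (begin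
        suc (expansion U) + κ     ≡⟨ +-suc (expansion U) κ ⟨
        expansion U + suc κ       ≤⟨ +-monoʳ-≤ (expansion U) κ<eI ⟩
        expansion U + expansion I ≤⟨ expansion-submodular A F ⟩
        expansion A + expansion F ≡⟨ cong₂ _+_ eA≡κ eF≡κ ⟩
        κ + κ                     ∎)

      ΓU-full : ∀ w → w ∈ Γ U
      ΓU-full w = ¬∉⇒∈ {Γ U} λ w∉ΓU → <⇒≱ eU<κ (κ-min ((x , ∈-∪ˡ {A} {F} x∈A) , (w , w∉ΓU)))

      κ<eU : κ < expansion U
      κ<eU = +-cancelʳ-≤ (card F* + card F) (suc κ) (expansion U) (begin
        suc κ + (card F* + card F)       ≡⟨ cong suc (x∙yz≈y∙xz κ (card F*) (card F)) ⟩
        suc (card F* + (κ + card F))     ≡⟨ cong suc (card-complement-Γ F-frag) ⟩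
        suc order                        ≡⟨ +-comm 1 order ⟩
        order + 1                        ≤⟨ +-monoʳ-≤ order (card-pos {I} (∈-∩ {A} {F} x∈A x∈F)) ⟩
        order + card I                   ≡⟨ cong (_+ card I) (trans (sym (card-full ΓU-full)) (card-Γ U)) ⟩
        (expansion U + card U) + card I  ≡⟨ +-assoc (expansion U) (card U) (card I) ⟩
        expansion U + (card U + card I)  ≡⟨ cong (expansion U +_) (card-∪-∩ A F) ⟩
        expansion U + (card A + card F)  ≤⟨ +-monoʳ-≤ (expansion U) (+-monoˡ-≤ (card F) (A-least F* (fragment-complement-Γ F-frag))) ⟩
        expansion U + (card F* + card F) ∎)

  atom-⊆-fragment : ∀ {A F x} → IsAtom A → IsFragment F → x ∈ A → x ∈ F → A ⊆ F
  atom-⊆-fragment {A} {F} A-atom F-frag x∈A x∈F with ⊆⊎∃∖ A F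
  ... | inj₁ A⊆F              = A⊆F
  ... | inj₂ (_ , y∈A , y∉F) = ⊥-elim (atom-∖-fragment-empty A-atom F-frag x∈A x∈F y∈A y∉F)

  atom-subgroup : ∀ {H} → IsAtom H → 0# ∈ H → IsSubgroup H
  atom-subgroup {H} H-atom 0∈H = subgroup-criterion 0∈H λ {x} x∈H y∈H →
    atom-⊆-fragment H-atom (fragment-+ₛ x (proj₁ H-atom)) x∈H (subst (_∈ H) (sym (inverseʳ x)) 0∈H) y∈H

  atom-through-0 : ∀ {A} → IsAtom A → Σ Subset λ H → IsAtom H × 0# ∈ H
  atom-through-0 {A} A-atom@((((a , a∈A) , _) , _) , _) =
    (- a) +ₛ A , atom-+ₛ (- a) A-atom , subst (_∈ A) (sym (trans (identityˡ (- - a)) (⁻¹-involutive a))) a∈A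

  separating⇒sumset≢G : ∀ {K} → IsSubgroup K → Separating K → ¬ (∀ g → g ∈ sumset S K)
  separating⇒sumset≢G {K} K≤G (_ , (y , y∉ΓK)) S+K-full =
    ∉⇒¬∈ {Γ K} y∉ΓK (trans (Γ-subgroup K≤G y) (S+K-full y))

  sumset≢G⇒separating : ∀ {K} → IsSubgroup K → ¬ (∀ g → g ∈ sumset S K) → Separating K
  sumset≢G⇒separating {K} K≤G S+K≠G with ¬full⇒∃∉ (sumset S K) S+K≠G
  ... | y , y∉S+K = (0# , IsSubgroup.has-0 K≤G) , (y , trans (Γ-subgroup K≤G y) y∉S+K)

  card-sumset-subgroup : ∀ {K} → IsSubgroup K → card (sumset S K) ∸ card K ≡ expansion K
  card-sumset-subgroup {K} K≤G = cong (_∸ card K) (card-cong (≐-sym (Γ-subgroup K≤G)))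

  coset⊆Γ-coset : ∀ {K} → IsSubgroup K → t +ₛ K ⊆ Γ (t +ₛ K)
  coset⊆Γ-coset {K} K≤G {y} y∈t+K = ∈-Γ {t +ₛ K} {t - h} t-h∈t+K (subst (_∈ S) (sym t-h+y≡t+t) t+t∈S)
    where
    open ≡-Reasoning
    h : Carrier
    h = y - t

    t-h∈t+K : (t - h) ∈ (t +ₛ K)
    t-h∈t+K = subst (_∈ K) (sym (xyx⁻¹≈y t (- h))) (IsSubgroup.neg-closed K≤G y∈t+K)

    t-h+y≡t+t : (t - h) ⊕ y ≡ t ⊕ t
    t-h+y≡t+t = begin
      (t - h) ⊕ y       ≡⟨ cong ((t - h) ⊕_) (//-rightDividesˡ t y) ⟨
      (t - h) ⊕ (h ⊕ t) ≡⟨ assoc (t - h) h t ⟨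
      ((t - h) ⊕ h) ⊕ t ≡⟨ cong (_⊕ t) (//-rightDividesˡ h t) ⟩
      t ⊕ t             ∎

  κ≤card-boundary : ∀ {X R v} → (∃ λ u → u ∈ R) → v ∉ X → ¬ v ∈ R →
                    (∀ {y} → y ∈ Γ R → y ∉ X → y ∈ R) → κ ≤ card X
  κ≤card-boundary {X} {R} {v} R-nonempty v∉X v∉R R-closed = ≤-trans (κ-min R-sep) (begin
    card (Γ R) ∸ card R         ≤⟨ ∸-monoˡ-≤ (card R) (card-mono ΓR⊆R∪X) ⟩
    card (R ∪ X) ∸ card R       ≤⟨ ∸-monoˡ-≤ (card R) (m+n≤o⇒m≤o _ (≤-reflexive (card-∪-∩ R X))) ⟩
    card R + card X ∸ card R    ≡⟨ m+n∸m≡n (card R) (card X) ⟩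
    card X                      ∎)
    where
    open ≤-Reasoning

    R-sep : Separating R
    R-sep = R-nonempty , (v , ¬∈⇒∉ {Γ R} λ v∈ΓR → v∉R (R-closed v∈ΓR v∉X))

    ΓR⊆R∪X : Γ R ⊆ R ∪ X
    ΓR⊆R∪X {y} y∈ΓR = ¬∉⇒∈ {R ∪ X} λ y∉R∪X →
      ∉⇒¬∈ {R ∪ X} y∉R∪X (∈-∪ˡ {R} {X} (R-closed y∈ΓR (∉-∪⁻ʳ {R} {X} y∉R∪X)))

  κ≤card-cut : ∀ {X} → IsCut S X → κ ≤ card X
  κ≤card-cut {X} (inj₁ |Xᶜ|≤1) = begin
    κ                                                  ≤⟨ κ-min separating-｛0｝ ⟩
    card (Γ ｛ 0# ｝) ∸ card ｛ 0# ｝                   ≤⟨ ∸-mono (card≤order (Γ ｛ 0# ｝)) (card-pos {｛ 0# ｝} (∈-｛｝ 0#)) ⟩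
    order ∸ 1                                          ≤⟨ ∸-monoʳ-≤ order |Xᶜ|≤1 ⟩
    order ∸ card (complement X)                        ≡⟨ cong (_∸ card (complement X)) (card-complement X) ⟨
    card X + card (complement X) ∸ card (complement X) ≡⟨ m+n∸n≡m (card X) (card (complement X)) ⟩
    card X                                             ∎
    where open ≤-Reasoning
  κ≤card-cut {X} (inj₂ (u , v , _ , v∉X , u↛v)) with component X u
  ... | R , u∈R , R-reachable , R-closed = κ≤card-boundary (u , u∈R) v∉X (u↛v ∘ R-reachable) R-closed

  fragment-boundary-cut : ∀ {C u} → IsFragment C → C ⊆ Γ C → u ∈ C →
                          IsCut S (Γ C ∖ C) × card (Γ C ∖ C) ≡ κ
  fragment-boundary-cut {C} {u} ((_ , (v , v∉ΓC)) , eC≡κ) C⊆ΓC u∈C =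
    inj₂ (u , v , ∈⇒∉-∖ {Γ C} {C} u∈C , ∉⇒∉-∖ {Γ C} {C} v∉ΓC , u↛v) ,
    +-cancelʳ-≡ (card C) _ _ (trans (card-∖ C⊆ΓC) (trans (card-Γ C) (cong (_+ card C) eC≡κ)))
    where
    u↛v : ¬ Reach S (Γ C ∖ C) u v
    u↛v u↝v = ∉⇒¬∈ {Γ C} v∉ΓC (C⊆ΓC (reach-closed (∉-∖⇒∈ {Γ C} {C}) u∈C u↝v))

  private
    atom-at-0 : Σ Subset λ H → IsAtom H × 0# ∈ H
    atom-at-0 = atom-through-0 (proj₂ atom)

    H : Subset
    H = proj₁ atom-at-0

    H-atom : IsAtom H
    H-atom = proj₁ (proj₂ atom-at-0)

    H-subgroup : IsSubgroup H
    H-subgroup = atom-subgroup H-atom (proj₂ (proj₂ atom-at-0))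

  κ-is-connectivity : IsKappa G S κ
  κ-is-connectivity =
    (Γ (t +ₛ H) ∖ (t +ₛ H) ,
     fragment-boundary-cut (fragment-+ₛ t (proj₁ H-atom)) (coset⊆Γ-coset H-subgroup)
                           (subst (_∈ H) (sym (inverseʳ t)) (IsSubgroup.has-0 H-subgroup))) ,
    λ _ → κ≤card-cut

  κ-is-subgroup-minimum : IsRHSMin G S κ
  κ-is-subgroup-minimum =
    (H , (H-subgroup , separating⇒sumset≢G H-subgroup (proj₁ (proj₁ H-atom))) ,
     trans (card-sumset-subgroup H-subgroup) (proj₂ (proj₁ H-atom))) ,
    λ K (K≤G , S+K≠G) → subst (κ ≤_) (sym (card-sumset-subgroup K≤G)) (κ-min (sumset≢G⇒separating K≤G S+K≠G))

open FinAbGroup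

corollary3 : (G : FinAbGroup) → (S : Subset G) →
    (∃ λ g → _∉_ G g S) →
    (∃ λ g → _∈_ G (_+_ G g g) S) →
    ∃ λ (k : ℕ) → IsKappa G S k × IsRHSMin G S k
corollary3 G S (_ , g₀∉S) (_ , t+t∈S) = κ , κ-is-connectivity , κ-is-subgroup-minimum
  where open Connectivity G S g₀∉S t+t∈S
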